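{- For all positive integers $d$ and $m$, \[ E^+_{d^m} = (-1)^d \det\big(H^+_{(1-i+j)^m}\big)_{1 \le i, j \le d} \qquad\text{and}\qquad H^+_{d^m} = (-1)^d \det\big(E^+_{(1-i+j)^m}\big)_{1 \le i, j \le d}. \]
   Context: $\mathsf{P\Lambda}$ denotes the $\mathbb{Q}$-algebra of polysymmetric functions: formal power series of bounded degree in variables $x_{i,j}$ ($i,j\ge1$), $x_{i,j}$ of degree $i$, invariant under every permutation of $x_{i,1},x_{i,2},\dots$ for each fixed $i$. A stack is a pair of positive integers $d^m$ (degree $d$, multiplicity $m$); a stack partition $\tau\Vdash n$ is a finite weakly decreasing sequence of stacks $(d_1^{m_1},\dots,d_s^{m_s})$ (with $d^m\ge d'^{m'}$ iff $d>d'$, or $d=d'$ and $m\ge m'$) with $\sum d_im_i=n$; an ordinary partition $\alpha\vdash n$ is one with all multiplicities $1$. Let $\operatorname{area}(\tau)=\sum_i m_i$. The monomial polysymmetric function is $M_\tau=\sum_\alpha x_{d_1,\alpha_1}^{m_1}\cdots x_{d_s,\alpha_s}^{m_s}$ over sequences $\alpha$ of positive integers with $\alpha_i\ne\alpha_j$ whenever $d_i=d_j$, $i\ne j$. Define $E^+_d=\sum_{\alpha\vdash d}M_\alpha$ and $H^+_d=\sum_{\alpha\Vdash d}(-1)^{\operatorname{area}(\alpha)}M_\alpha$, so that $\sum_{d\ge0}E^+_dt^d=\prod_{i,j}(1+x_{i,j}t^i)$ and $\sum_{d\ge0}H^+_dt^d=\prod_{i,j}(1+x_{i,j}t^i)^{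 -1}$; $E^+_0=H^+_0=1$ and these are $0$ for negative index. For $F\in\{E^+,H^+\}$, $F_{d^m}$ denotes $F_d$ with each $x_{i,j}$ replaced by $x_{i,j}^m$. -}

module Defs where

open import Data.Nat as ℕ using (ℕ; zero; suc; NonZero; _∸_)
open import Data.Integer as ℤ using (ℤ; +_; -[1+_])
open import Data.Rational as ℚ using (ℚ; 0ℚ; 1ℚ)
open import Data.List using (List; []; _∷_; [_]; map; concatMap; upTo; foldr)
open import Data.Bool.ListAction using (and; all)
open import Data.Fin as Fin using (Fin; toℕ; punchIn)
open import Data.Bool using (Bool; true; false; if_then_else_; _∧_)
open import Data.Product using (_×_; _,_; proj₁; proj₂)
open import Relation.Binary.PropositionalEquality using (_≡_)

-- A monomial is a list of rows; row number r (0-based) collects the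
-- variables x_{r+1,1}, x_{r+1,2}, …, and entry number c (0-based) of that
-- row is the exponent of x_{r+1,c+1}.  Missing entries / rows mean
-- exponent 0 (so trailing zeros give the same monomial).

Mon : Set
Mon = List (List ℕ)

-- Formal power series with rational coefficients in the x_{i,j}:
-- the coefficient of each monomial.
Series : Set
Series = Mon → ℚ

infix 4 _≈ₛ_
_≈ₛ_ : Series → Series → Set
f ≈ₛ g = ∀ μ → f μ ≡ g μ

sumℚ : List ℚ → ℚ
sumℚ = foldr ℚ._+_ 0ℚ

sumℕ : List ℕ → ℕ
sumℕ = foldr ℕ._+_ 0

splitRow : List ℕ → List (List ℕ × List ℕ)
splitRow [] = [ ([] , []) ]
splitRow (e ∷ es) =
  concatMap (λ a → map (λ pq → (a ∷ proj₁ pq , (e ∸ a) ∷ proj₂ pq)) (splitRow es))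
            (upTo (suc e))

splitMon : Mon → List (Mon × Mon)
splitMon [] = [ ([] , []) ]
splitMon (r ∷ rs) =
  concatMap (λ ab → map (λ pq → (proj₁ ab ∷ proj₁ pq , proj₂ ab ∷ proj₂ pq)) (splitMon rs))
            (splitRow r)

0ₛ : Series
0ₛ _ = 0ℚ

isOne : Mon → Bool
isOne μ = and (map (all (λ e → e ℕ.≡ᵇ 0)) μ)

1ₛ : Series
1ₛ μ = if isOne μ then 1ℚ else 0ℚ

infixl 6 _+ₛ_
_+ₛ_ : Series → Series → Series
(f +ₛ g) μ = f μ ℚ.+ g μ

-ₛ_ : Series → Series
(-ₛ f) μ = ℚ.- (f μ)

infixl 7 _*ₛ_
_*ₛ_ : Series → Series → Series
(f *ₛ g) μ = sumℚ (map (λ pq → f (proj₁ pq) ℚ.* g (proj₂ pq)) (splitMon μ))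

signₛ : ℕ → Series → Series
signₛ zero f = f
signₛ (suc n) f = -ₛ signₛ n f

sumFin : ∀ n → (Fin n → Series) → Series
sumFin zero f = 0ₛ
sumFin (suc n) f = f Fin.zero +ₛ sumFin n (λ j → f (Fin.suc j))

det : ∀ n → (Fin n → Fin n → Series) → Series
det zero A = 1ₛ
det (suc n) A =
  sumFin (suc n) (λ j →
    signₛ (toℕ j) (A Fin.zero j *ₛ det n (λ k l → A (Fin.suc k) (punchIn j l))))

-- weighted degree: x_{i,j} has degree i
wdegFrom : ℕ → Mon → ℕ
wdegFrom k [] = 0
wdegFrom k (r ∷ rs) = k ℕ.* sumℕ r ℕ.+ wdegFrom (suc k) rs

wdeg : Mon → ℕ
wdeg = wdegFrom 1

-- total exponent (= area of the corresponding stack partition)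
area : Mon → ℕ
area μ = sumℕ (map sumℕ μ)

squarefree : Mon → Bool
squarefree μ = and (map (all (λ e → e ℕ.≤ᵇ 1)) μ)

parity : ℕ → ℚ
parity zero = 1ℚ
parity (suc n) = ℚ.- parity n

-- E⁺_d = Σ_{α ⊢ d} M_α : coefficient 1 on squarefree monomials of degree d
E⁺ : ℕ → Series
E⁺ d μ = if (wdeg μ ℕ.≡ᵇ d) ∧ squarefree μ then 1ℚ else 0ℚ

-- H⁺_d = Σ_{α ⊩ d} (-1)^{area α} M_α
H⁺ : ℕ → Series
H⁺ d μ = if wdeg μ ℕ.≡ᵇ d then parity (area μ) else 0ℚ

-- substitution x_{i,j} ↦ x_{i,j}^m
divRow : (m : ℕ) .{{_ : NonZero m}} → List ℕ → Bool
divRow m = all (λ e → (e ℕ.% m) ℕ.≡ᵇ 0)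

powSubst : (m : ℕ) .{{_ : NonZero m}} → Series → Series
powSubst m f μ =
  if and (map (divRow m) μ) then f (map (map (λ e → e ℕ./ m)) μ) else 0ℚ

-- F_{k^m} for an integer index k (zero for negative k)
stack : (ℕ → Series) → ℤ → (m : ℕ) .{{_ : NonZero m}} → Series
stack F (+ k) m = powSubst m (F k)
stack F -[1+ k ] m = 0ₛ

-- the index 1 - i + j (for 1-based i, j; same for 0-based)
idx : ∀ {n} → Fin n → Fin n → ℤ
idx i j = (+ 1 ℤ.- + toℕ i) ℤ.+ + toℕ j

{-# OPTIONS --safe #-}

-- Write Π φ for the series ∏_{i,j} (Σₑ φ e · x_{i,j}^e). Then H⁺_d and E⁺_d are the degree-d parts
-- of Π parity = ∏ (1 + x_{i,j})⁻¹ and Π bit = ∏ (1 + x_{i,j}), and the substitution x ↦ xᵐ turns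
-- them into the parts of Π (dilate parity) and Π (dilate bit) whose quotient monomial has degree d.
-- A coefficient of a product Π φ · Π ψ factors over the exponents, so Σᵢ H⁺_{iᵐ} E⁺_{(n-i)ᵐ} = 0 for
-- n > 0 reduces to the one-variable identity (1 + tᵐ)⁻¹ (1 + tᵐ) = 1. Finally, whenever F₀ = G₀ = 1
-- and Σᵢ Fᵢ G_{n-i} = 0 for n > 0, expanding det (F_{1-i+j}) along its first row gives the recursion
-- satisfied by (-1)ᵈ G_d: each first-row minor is block triangular with a unit triangular block.

module Submission where

open import Defs
open import Data.Nat as ℕ using (ℕ; zero; suc; NonZero; _∸_; _≤_; _<_; z≤n; s≤s; _≡ᵇ_; _≤ᵇ_; _%_; _/_)
import Data.Nat.Properties as ℕP
import Data.Nat.DivMod as DivMod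
open import Data.Integer as ℤ using (ℤ; -[1+_]; _⊖_)
import Data.Integer.Properties as ℤP
open import Data.Rational using (ℚ; 0ℚ; 1ℚ; _+_; _*_; -_)
open import Data.Rational.Properties
open import Data.Bool using (Bool; true; false; if_then_else_; _∧_; T)
open import Data.Bool.Properties using (∧-conicalˡ; ∧-conicalʳ)
open import Data.Bool.ListAction using (and; all)
open import Data.List using (List; []; _∷_; map; concatMap; upTo; applyUpTo; foldr; _++_)
open import Data.Fin as Fin using (Fin; toℕ; punchIn; punchOut)
open import Data.Fin.Properties using (toℕ<n; punchIn-punchOut) renaming (_≟_ to _≟ᶠ_)
open import Data.Product using (_×_; _,_; proj₁; proj₂)
open import Data.Unit using (tt)
open import Data.Empty using (⊥-elim)
open import Function using (_∘_; id)
open import Relation.Nullary using (yes; no)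
open import Relation.Binary.Bundles using (Setoid)
import Relation.Binary.Reasoning.Setoid as SetoidReasoning
open import Relation.Binary.PropositionalEquality
open import Algebra.Bundles using (CommutativeMonoid)
import Algebra.Properties.CommutativeSemigroup as CommSemigroupProperties

open import Algebra.Properties.Group +-0-group
  using () renaming (⁻¹-involutive to neg-involutive; inverseʳ-unique to +-inverseʳ-unique)
open CommSemigroupProperties (CommutativeMonoid.commutativeSemigroup +-0-commutativeMonoid)
  using () renaming (interchange to +-interchange)
open CommSemigroupProperties (CommutativeMonoid.commutativeSemigroup *-1-commutativeMonoid)
  using () renaming (interchange to *-interchange)
open CommSemigroupProperties ℕP.+-commutativeSemigroup
  using () renaming (interchange to ℕ-+-interchange)

sumL : {A : Set} → (A → ℚ) → List A → ℚ
sumL f xs = sumℚ (map f xs)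

prodL : {A : Set} → (A → ℚ) → List A → ℚ
prodL f = foldr (λ x acc → f x * acc) 1ℚ

module _ {A : Set} where

  sumL-cong : {f g : A → ℚ} (xs : List A) → (∀ x → f x ≡ g x) → sumL f xs ≡ sumL g xs
  sumL-cong []       f≗g = refl
  sumL-cong (x ∷ xs) f≗g = cong₂ _+_ (f≗g x) (sumL-cong xs f≗g)

  prodL-cong : {f g : A → ℚ} (xs : List A) → (∀ x → f x ≡ g x) → prodL f xs ≡ prodL g xs
  prodL-cong []       f≗g = refl
  prodL-cong (x ∷ xs) f≗g = cong₂ _*_ (f≗g x) (prodL-cong xs f≗g)

  sumL-zero : (xs : List A) → sumL (λ _ → 0ℚ) xs ≡ 0ℚ
  sumL-zero []       = refl
  sumL-zero (x ∷ xs) = trans (+-identityˡ _) (sumL-zero xs)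

  sumL-++ : (f : A → ℚ) (xs ys : List A) → sumL f (xs ++ ys) ≡ sumL f xs + sumL f ys
  sumL-++ f []       ys = sym (+-identityˡ _)
  sumL-++ f (x ∷ xs) ys = trans (cong (f x +_) (sumL-++ f xs ys)) (sym (+-assoc (f x) _ _))

  sumL-+ : (f g : A → ℚ) (xs : List A) → sumL (λ x → f x + g x) xs ≡ sumL f xs + sumL g xs
  sumL-+ f g []       = refl
  sumL-+ f g (x ∷ xs) = trans (cong (f x + g x +_) (sumL-+ f g xs)) (+-interchange (f x) (g x) _ _)

  sumL-*ˡ : (c : ℚ) (f : A → ℚ) (xs : List A) → sumL (λ x → c * f x) xs ≡ c * sumL f xs
  sumL-*ˡ c f []       = sym (*-zeroʳ c)
  sumL-*ˡ c f (x ∷ xs) = trans (cong (c * f x +_) (sumL-*ˡ c f xs)) (sym (*-distribˡ-+ c (f x) _))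

  sumL-neg : (f : A → ℚ) (xs : List A) → sumL (λ x → - f x) xs ≡ - sumL f xs
  sumL-neg f []       = refl
  sumL-neg f (x ∷ xs) = trans (cong (- f x +_) (sumL-neg f xs)) (sym (neg-distrib-+ (f x) _))

sumL-map : {A B : Set} (f : B → ℚ) (g : A → B) (xs : List A) → sumL f (map g xs) ≡ sumL (f ∘ g) xs
sumL-map f g []       = refl
sumL-map f g (x ∷ xs) = cong (f (g x) +_) (sumL-map f g xs)

sumL-concatMap : {A B : Set} (f : B → ℚ) (g : A → List B) (xs : List A) →
  sumL f (concatMap g xs) ≡ sumL (λ x → sumL f (g x)) xs
sumL-concatMap f g []       = refl
sumL-concatMap f g (x ∷ xs) =
  trans (sumL-++ f (g x) _) (cong (sumL f (g x) +_) (sumL-concatMap f g xs))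

sumBelow : ℕ → (ℕ → ℚ) → ℚ
sumBelow zero    f = 0ℚ
sumBelow (suc n) f = f 0 + sumBelow n (f ∘ suc)

syntax sumBelow n (λ i → e) = ∑[ i < n ] e

sumBelow-cong : ∀ n {f g : ℕ → ℚ} → (∀ i → i < n → f i ≡ g i) → sumBelow n f ≡ sumBelow n g
sumBelow-cong zero    f≗g = refl
sumBelow-cong (suc n) f≗g =
  cong₂ _+_ (f≗g 0 (s≤s z≤n)) (sumBelow-cong n (λ i i<n → f≗g (suc i) (s≤s i<n)))

sumBelow-zero : ∀ n {f : ℕ → ℚ} → (∀ i → i < n → f i ≡ 0ℚ) → sumBelow n f ≡ 0ℚ
sumBelow-zero zero    f≗0 = refl
sumBelow-zero (suc n) f≗0 = trans
  (cong₂ _+_ (f≗0 0 (s≤s z≤n)) (sumBelow-zero n (λ i i<n → f≗0 (suc i) (s≤s i<n))))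
  (+-identityˡ 0ℚ)

sumBelow-snoc : ∀ n (f : ℕ → ℚ) → sumBelow (suc n) f ≡ sumBelow n f + f n
sumBelow-snoc zero    f = trans (+-identityʳ (f 0)) (sym (+-identityˡ (f 0)))
sumBelow-snoc (suc n) f = trans (cong (f 0 +_) (sumBelow-snoc n (f ∘ suc))) (sym (+-assoc (f 0) _ _))

sumBelow-+ : ∀ a b (f : ℕ → ℚ) → sumBelow (a ℕ.+ b) f ≡ sumBelow a f + ∑[ i < b ] f (a ℕ.+ i)
sumBelow-+ zero    b f = sym (+-identityˡ _)
sumBelow-+ (suc a) b f = trans (cong (f 0 +_) (sumBelow-+ a b (f ∘ suc))) (sym (+-assoc (f 0) _ _))

sumBelow-reverse : ∀ n (f : ℕ → ℚ) → ∑[ i < suc n ] f (n ∸ i) ≡ sumBelow (suc n) f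
sumBelow-reverse zero    f = refl
sumBelow-reverse (suc n) f = begin
  f (suc n) + ∑[ i < suc n ] f (n ∸ i) ≡⟨ cong (f (suc n) +_) (sumBelow-reverse n f) ⟩
  f (suc n) + sumBelow (suc n) f       ≡⟨ +-comm (f (suc n)) _ ⟩
  sumBelow (suc n) f + f (suc n)       ≡⟨ sym (sumBelow-snoc (suc n) f) ⟩
  sumBelow (suc (suc n)) f             ∎
  where open ≡-Reasoning

sumBelow-*ʳ : ∀ n (f : ℕ → ℚ) c → ∑[ i < n ] (f i * c) ≡ sumBelow n f * c
sumBelow-*ʳ zero    f c = sym (*-zeroˡ c)
sumBelow-*ʳ (suc n) f c =
  trans (cong (f 0 * c +_) (sumBelow-*ʳ n (f ∘ suc) c)) (sym (*-distribʳ-+ c (f 0) _))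

sumL-applyUpTo : ∀ (f : ℕ → ℚ) g n → sumL f (applyUpTo g n) ≡ sumBelow n (f ∘ g)
sumL-applyUpTo f g zero    = refl
sumL-applyUpTo f g (suc n) = cong (f (g 0) +_) (sumL-applyUpTo f (g ∘ suc) n)

sumBelow-sumL : {A : Set} (f : ℕ → A → ℚ) (n : ℕ) (xs : List A) →
  ∑[ i < n ] sumL (f i) xs ≡ sumL (λ x → ∑[ i < n ] f i x) xs
sumBelow-sumL f zero    xs = sym (sumL-zero xs)
sumBelow-sumL f (suc n) xs = begin
  sumL (f 0) xs + ∑[ i < n ] sumL (f (suc i)) xs
    ≡⟨ cong (sumL (f 0) xs +_) (sumBelow-sumL (f ∘ suc) n xs) ⟩
  sumL (f 0) xs + sumL (λ x → ∑[ i < n ] f (suc i) x) xs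
    ≡⟨ sym (sumL-+ (f 0) _ xs) ⟩
  sumL (λ x → ∑[ i < suc n ] f i x) xs ∎
  where open ≡-Reasoning

ι : Bool → ℚ
ι b = if b then 1ℚ else 0ℚ

ι-∧ : ∀ a b → ι (a ∧ b) ≡ ι a * ι b
ι-∧ true  b = sym (*-identityˡ (ι b))
ι-∧ false b = sym (*-zeroˡ (ι b))

if-ι : ∀ b x → (if b then x else 0ℚ) ≡ ι b * x
if-ι true  x = sym (*-identityˡ x)
if-ι false x = sym (*-zeroˡ x)

if-∧-* : ∀ a b x y → (if a ∧ b then x * y else 0ℚ) ≡ (if a then x else 0ℚ) * (if b then y else 0ℚ)
if-∧-* true  true  x y = refl
if-∧-* true  false x y = sym (*-zeroʳ x)
if-∧-* false b     x y = sym (*-zeroˡ (if b then y else 0ℚ))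

*-cong-zeroʳ : ∀ a b {c} → c ≡ 0ℚ → a * c ≡ b * c
*-cong-zeroʳ a b c≡0 =
  trans (cong (a *_) c≡0) (trans (*-zeroʳ a) (sym (trans (cong (b *_) c≡0) (*-zeroʳ b))))

≡ᵇ-sound : ∀ a b → (a ≡ᵇ b) ≡ true → a ≡ b
≡ᵇ-sound a b a≡ᵇb = ℕP.≡ᵇ⇒≡ a b (subst T (sym a≡ᵇb) tt)

prodL-ι : ∀ (p : ℕ → Bool) r → prodL (ι ∘ p) r ≡ ι (all p r)
prodL-ι p []      = refl
prodL-ι p (x ∷ r) = trans (cong (ι (p x) *_) (prodL-ι p r)) (sym (ι-∧ (p x) (all p r)))

-- Coefficients of products of series

sumL-splitRow : ∀ (φ : List ℕ × List ℕ → ℚ) e es →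
  sumL φ (splitRow (e ∷ es)) ≡
  ∑[ x < suc e ] sumL (λ ab → φ (x ∷ proj₁ ab , (e ∸ x) ∷ proj₂ ab)) (splitRow es)
sumL-splitRow φ e es = begin
  sumL φ (concatMap cons (upTo (suc e)))
    ≡⟨ sumL-concatMap φ cons (upTo (suc e)) ⟩
  sumL (λ x → sumL φ (cons x)) (upTo (suc e))
    ≡⟨ sumL-applyUpTo (λ x → sumL φ (cons x)) id (suc e) ⟩
  ∑[ x < suc e ] sumL φ (cons x)
    ≡⟨ sumBelow-cong (suc e) (λ x _ → sumL-map φ (consPair x) (splitRow es)) ⟩
  _ ∎
  where
  open ≡-Reasoning
  consPair : ℕ → List ℕ × List ℕ → List ℕ × List ℕ
  consPair x (a , b) = x ∷ a , (e ∸ x) ∷ b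
  cons : ℕ → List (List ℕ × List ℕ)
  cons x = map (consPair x) (splitRow es)

sumL-splitMon : ∀ (φ : Mon × Mon → ℚ) r rs →
  sumL φ (splitMon (r ∷ rs)) ≡
  sumL (λ ab → sumL (λ pq → φ (proj₁ ab ∷ proj₁ pq , proj₂ ab ∷ proj₂ pq)) (splitMon rs)) (splitRow r)
sumL-splitMon φ r rs = trans (sumL-concatMap φ cons (splitRow r))
  (sumL-cong (splitRow r) (λ ab → sumL-map φ (consPair ab) (splitMon rs)))
  where
  consPair : List ℕ × List ℕ → Mon × Mon → Mon × Mon
  consPair (a , b) (p , q) = a ∷ p , b ∷ q
  cons : List ℕ × List ℕ → List (Mon × Mon)
  cons ab = map (consPair ab) (splitMon rs)

infixr 5 _∷_
data RowSplit : List ℕ → List ℕ → List ℕ → Set where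
  []  : RowSplit [] [] []
  _∷_ : ∀ {a b e as bs es} → a ℕ.+ b ≡ e → RowSplit as bs es → RowSplit (a ∷ as) (b ∷ bs) (e ∷ es)

data MonSplit : Mon → Mon → Mon → Set where
  []  : MonSplit [] [] []
  _∷_ : ∀ {a b r p q μ} → RowSplit a b r → MonSplit p q μ → MonSplit (a ∷ p) (b ∷ q) (r ∷ μ)

sumL-splitRow-cong : ∀ r {φ ψ : List ℕ × List ℕ → ℚ} →
  (∀ a b → RowSplit a b r → φ (a , b) ≡ ψ (a , b)) → sumL φ (splitRow r) ≡ sumL ψ (splitRow r)
sumL-splitRow-cong []       φ≗ψ = cong (_+ 0ℚ) (φ≗ψ [] [] [])
sumL-splitRow-cong (e ∷ es) {φ} {ψ} φ≗ψ = begin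
  sumL φ (splitRow (e ∷ es)) ≡⟨ sumL-splitRow φ e es ⟩
  _                          ≡⟨ sumBelow-cong (suc e) (λ x x≤e → sumL-splitRow-cong es (λ a b split →
                                  φ≗ψ (x ∷ a) ((e ∸ x) ∷ b) (ℕP.m+[n∸m]≡n (ℕP.≤-pred x≤e) ∷ split))) ⟩
  _                          ≡⟨ sym (sumL-splitRow ψ e es) ⟩
  sumL ψ (splitRow (e ∷ es)) ∎
  where open ≡-Reasoning

sumL-splitMon-cong : ∀ μ {φ ψ : Mon × Mon → ℚ} →
  (∀ p q → MonSplit p q μ → φ (p , q) ≡ ψ (p , q)) → sumL φ (splitMon μ) ≡ sumL ψ (splitMon μ)
sumL-splitMon-cong []       φ≗ψ = cong (_+ 0ℚ) (φ≗ψ [] [] [])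
sumL-splitMon-cong (r ∷ rs) {φ} {ψ} φ≗ψ = begin
  sumL φ (splitMon (r ∷ rs)) ≡⟨ sumL-splitMon φ r rs ⟩
  _                          ≡⟨ sumL-splitRow-cong r (λ a b rowSplit → sumL-splitMon-cong rs (λ p q split →
                                  φ≗ψ (a ∷ p) (b ∷ q) (rowSplit ∷ split))) ⟩
  _                          ≡⟨ sym (sumL-splitMon ψ r rs) ⟩
  sumL ψ (splitMon (r ∷ rs)) ∎
  where open ≡-Reasoning

infixl 7 _⊛_
_⊛_ : (ℕ → ℚ) → (ℕ → ℚ) → ℕ → ℚ
(φ ⊛ ψ) e = ∑[ x < suc e ] (φ x * ψ (e ∸ x))

⊛-comm : ∀ φ ψ e → (φ ⊛ ψ) e ≡ (ψ ⊛ φ) e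
⊛-comm φ ψ e = begin
  (φ ⊛ ψ) e
    ≡⟨ sym (sumBelow-reverse e (λ x → φ x * ψ (e ∸ x))) ⟩
  ∑[ x < suc e ] (φ (e ∸ x) * ψ (e ∸ (e ∸ x)))
    ≡⟨ sumBelow-cong (suc e) (λ x x≤e → trans (cong (λ y → φ (e ∸ x) * ψ y) (ℕP.m∸[m∸n]≡n (ℕP.≤-pred x≤e)))
                                              (*-comm (φ (e ∸ x)) (ψ x))) ⟩
  (ψ ⊛ φ) e ∎
  where open ≡-Reasoning

δ : ℕ → ℕ → ℚ
δ a b = ι (a ≡ᵇ b)

δ-⊛ : ∀ a b s → (δ a ⊛ δ b) s ≡ δ (a ℕ.+ b) s
δ-⊛ zero    b zero    = trans (+-identityʳ _) (*-identityˡ (δ b 0))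
δ-⊛ (suc a) b zero    = trans (+-identityʳ _) (*-zeroˡ (δ b 0))
δ-⊛ zero    b (suc s) = trans
  (cong₂ _+_ (*-identityˡ (δ b (suc s))) (sumBelow-zero (suc s) (λ x _ → *-zeroˡ (δ b (s ∸ x)))))
  (+-identityʳ _)
δ-⊛ (suc a) b (suc s) = trans (cong₂ _+_ (*-zeroˡ (δ b (suc s))) (δ-⊛ a b s)) (+-identityˡ _)

δ-pos-0 : ∀ {a} → 0 < a → δ a 0 ≡ 0ℚ
δ-pos-0 {suc a} _ = refl

sumL-splitRow-prodL : ∀ φ ψ r →
  sumL (λ ab → prodL φ (proj₁ ab) * prodL ψ (proj₂ ab)) (splitRow r) ≡ prodL (φ ⊛ ψ) r
sumL-splitRow-prodL φ ψ []       = refl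
sumL-splitRow-prodL φ ψ (e ∷ es) = begin
  sumL F (splitRow (e ∷ es))
    ≡⟨ sumL-splitRow F e es ⟩
  ∑[ x < suc e ] sumL (λ ab → (φ x * prodL φ (proj₁ ab)) * (ψ (e ∸ x) * prodL ψ (proj₂ ab))) (splitRow es)
    ≡⟨ sumBelow-cong (suc e) (λ x _ → trans
         (sumL-cong (splitRow es) (λ ab → *-interchange (φ x) (prodL φ (proj₁ ab)) (ψ (e ∸ x)) (prodL ψ (proj₂ ab))))
         (sumL-*ˡ (φ x * ψ (e ∸ x)) F (splitRow es))) ⟩
  ∑[ x < suc e ] ((φ x * ψ (e ∸ x)) * sumL F (splitRow es))
    ≡⟨ sumBelow-*ʳ (suc e) (λ x → φ x * ψ (e ∸ x)) _ ⟩
  (φ ⊛ ψ) e * sumL F (splitRow es)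
    ≡⟨ cong ((φ ⊛ ψ) e *_) (sumL-splitRow-prodL φ ψ es) ⟩
  prodL (φ ⊛ ψ) (e ∷ es) ∎
  where
  open ≡-Reasoning
  F : List ℕ × List ℕ → ℚ
  F ab = prodL φ (proj₁ ab) * prodL ψ (proj₂ ab)

sumL-splitMon-prodL : ∀ (f g : List ℕ → ℚ) μ →
  sumL (λ pq → prodL f (proj₁ pq) * prodL g (proj₂ pq)) (splitMon μ) ≡
  prodL (λ r → sumL (λ ab → f (proj₁ ab) * g (proj₂ ab)) (splitRow r)) μ
sumL-splitMon-prodL f g []       = refl
sumL-splitMon-prodL f g (r ∷ rs) = begin
  sumL F (splitMon (r ∷ rs))
    ≡⟨ sumL-splitMon F r rs ⟩
  sumL (λ ab → sumL (λ pq → (f (proj₁ ab) * prodL f (proj₁ pq)) * (g (proj₂ ab) * prodL g (proj₂ pq)))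
                    (splitMon rs)) (splitRow r)
    ≡⟨ sumL-cong (splitRow r) (λ ab → trans
         (sumL-cong (splitMon rs) (λ pq →
            *-interchange (f (proj₁ ab)) (prodL f (proj₁ pq)) (g (proj₂ ab)) (prodL g (proj₂ pq))))
         (sumL-*ˡ (f (proj₁ ab) * g (proj₂ ab)) F (splitMon rs))) ⟩
  sumL (λ ab → (f (proj₁ ab) * g (proj₂ ab)) * sumL F (splitMon rs)) (splitRow r)
    ≡⟨ sumL-cong (splitRow r) (λ ab → *-comm _ (sumL F (splitMon rs))) ⟩
  sumL (λ ab → sumL F (splitMon rs) * (f (proj₁ ab) * g (proj₂ ab))) (splitRow r)
    ≡⟨ sumL-*ˡ (sumL F (splitMon rs)) _ (splitRow r) ⟩
  sumL F (splitMon rs) * R r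
    ≡⟨ *-comm _ (R r) ⟩
  R r * sumL F (splitMon rs)
    ≡⟨ cong (R r *_) (sumL-splitMon-prodL f g rs) ⟩
  prodL R (r ∷ rs) ∎
  where
  open ≡-Reasoning
  F : Mon × Mon → ℚ
  F pq = prodL f (proj₁ pq) * prodL g (proj₂ pq)
  R : List ℕ → ℚ
  R r = sumL (λ ab → f (proj₁ ab) * g (proj₂ ab)) (splitRow r)

Π : (ℕ → ℚ) → Series
Π φ = prodL (prodL φ)

Π-*ₛ : ∀ φ ψ → Π φ *ₛ Π ψ ≈ₛ Π (φ ⊛ ψ)
Π-*ₛ φ ψ μ = trans (sumL-splitMon-prodL (prodL φ) (prodL ψ) μ)
                   (prodL-cong μ (sumL-splitRow-prodL φ ψ))

Π-ι : ∀ (p : ℕ → Bool) ν → Π (ι ∘ p) ν ≡ ι (and (map (all p) ν))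
Π-ι p []      = refl
Π-ι p (r ∷ ν) = trans (cong₂ _*_ (prodL-ι p r) (Π-ι p ν)) (sym (ι-∧ (all p r) (and (map (all p) ν))))

isZeroRow : List ℕ → Bool
isZeroRow = all (λ e → e ≡ᵇ 0)

sumL-splitRow-unit : ∀ r (g : List ℕ → ℚ) →
  sumL (λ ab → ι (isZeroRow (proj₁ ab)) * g (proj₂ ab)) (splitRow r) ≡ g r
sumL-splitRow-unit []       g = trans (+-identityʳ _) (*-identityˡ (g []))
sumL-splitRow-unit (e ∷ es) g = begin
  sumL _ (splitRow (e ∷ es))
    ≡⟨ sumL-splitRow _ e es ⟩
  sumL (λ ab → ι (isZeroRow (proj₁ ab)) * g (e ∷ proj₂ ab)) (splitRow es) +
    ∑[ x < e ] sumL (λ ab → ι false * g ((e ∸ suc x) ∷ proj₂ ab)) (splitRow es)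
    ≡⟨ cong₂ _+_ (sumL-splitRow-unit es (g ∘ (e ∷_)))
                 (sumBelow-zero e (λ x _ → trans
                    (sumL-cong (splitRow es) (λ ab → *-zeroˡ (g ((e ∸ suc x) ∷ proj₂ ab))))
                    (sumL-zero (splitRow es)))) ⟩
  g (e ∷ es) + 0ℚ
    ≡⟨ +-identityʳ _ ⟩
  g (e ∷ es) ∎
  where open ≡-Reasoning

*ₛ-identityˡ : ∀ g → 1ₛ *ₛ g ≈ₛ g
*ₛ-identityˡ g []       = trans (+-identityʳ _) (*-identityˡ (g []))
*ₛ-identityˡ g (r ∷ rs) = begin
  sumL _ (splitMon (r ∷ rs))
    ≡⟨ sumL-splitMon _ r rs ⟩
  sumL (λ ab → sumL (λ pq → ι (isZeroRow (proj₁ ab) ∧ isOne (proj₁ pq)) * g (proj₂ ab ∷ proj₂ pq))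
                    (splitMon rs)) (splitRow r)
    ≡⟨ sumL-cong (splitRow r) (λ ab → begin
         sumL (λ pq → ι (isZeroRow (proj₁ ab) ∧ isOne (proj₁ pq)) * g (proj₂ ab ∷ proj₂ pq)) (splitMon rs)
           ≡⟨ sumL-cong (splitMon rs) (λ pq →
                trans (cong (_* g (proj₂ ab ∷ proj₂ pq)) (ι-∧ (isZeroRow (proj₁ ab)) (isOne (proj₁ pq))))
                      (*-assoc (ι (isZeroRow (proj₁ ab))) _ _)) ⟩
         sumL (λ pq → ι (isZeroRow (proj₁ ab)) * (1ₛ (proj₁ pq) * g (proj₂ ab ∷ proj₂ pq))) (splitMon rs)
           ≡⟨ sumL-*ˡ (ι (isZeroRow (proj₁ ab))) _ (splitMon rs) ⟩
         ι (isZeroRow (proj₁ ab)) * (1ₛ *ₛ (g ∘ (proj₂ ab ∷_))) rs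
           ≡⟨ cong (ι (isZeroRow (proj₁ ab)) *_) (*ₛ-identityˡ (g ∘ (proj₂ ab ∷_)) rs) ⟩
         ι (isZeroRow (proj₁ ab)) * g (proj₂ ab ∷ rs) ∎) ⟩
  sumL (λ ab → ι (isZeroRow (proj₁ ab)) * g (proj₂ ab ∷ rs)) (splitRow r)
    ≡⟨ sumL-splitRow-unit r (λ b → g (b ∷ rs)) ⟩
  g (r ∷ rs) ∎
  where open ≡-Reasoning

-- Series algebra and determinants

≈ₛ-sym : ∀ {f g} → f ≈ₛ g → g ≈ₛ f
≈ₛ-sym f≈g μ = sym (f≈g μ)

≈ₛ-trans : ∀ {f g h} → f ≈ₛ g → g ≈ₛ h → f ≈ₛ h
≈ₛ-trans f≈g g≈h μ = trans (f≈g μ) (g≈h μ)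

≈ₛ-setoid : Setoid _ _
≈ₛ-setoid = record
  { Carrier       = Series
  ; _≈_           = _≈ₛ_
  ; isEquivalence = record { refl = λ _ → refl ; sym = ≈ₛ-sym ; trans = ≈ₛ-trans }
  }

module ≈ₛ-Reasoning = SetoidReasoning ≈ₛ-setoid

+ₛ-cong : ∀ {f f′ g g′} → f ≈ₛ f′ → g ≈ₛ g′ → f +ₛ g ≈ₛ f′ +ₛ g′
+ₛ-cong f≈f′ g≈g′ μ = cong₂ _+_ (f≈f′ μ) (g≈g′ μ)

-ₛ-cong : ∀ {f f′} → f ≈ₛ f′ → -ₛ f ≈ₛ -ₛ f′
-ₛ-cong f≈f′ μ = cong -_ (f≈f′ μ)

*ₛ-cong : ∀ {f f′ g g′} → f ≈ₛ f′ → g ≈ₛ g′ → f *ₛ g ≈ₛ f′ *ₛ g′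
*ₛ-cong f≈f′ g≈g′ μ = sumL-cong (splitMon μ) (λ pq → cong₂ _*_ (f≈f′ (proj₁ pq)) (g≈g′ (proj₂ pq)))

*ₛ-congˡ : ∀ f {g g′} → g ≈ₛ g′ → f *ₛ g ≈ₛ f *ₛ g′
*ₛ-congˡ f = *ₛ-cong {f} (λ _ → refl)

signₛ-cong : ∀ n {f f′} → f ≈ₛ f′ → signₛ n f ≈ₛ signₛ n f′
signₛ-cong zero    f≈f′ = f≈f′
signₛ-cong (suc n) f≈f′ = -ₛ-cong (signₛ-cong n f≈f′)

*ₛ-zeroˡ : ∀ {f} g → f ≈ₛ 0ₛ → f *ₛ g ≈ₛ 0ₛ
*ₛ-zeroˡ g f≈0 μ = trans
  (sumL-cong (splitMon μ) (λ pq → trans (cong (_* g (proj₂ pq)) (f≈0 (proj₁ pq))) (*-zeroˡ (g (proj₂ pq)))))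
  (sumL-zero (splitMon μ))

*ₛ-zeroʳ : ∀ f {g} → g ≈ₛ 0ₛ → f *ₛ g ≈ₛ 0ₛ
*ₛ-zeroʳ f g≈0 μ = trans
  (sumL-cong (splitMon μ) (λ pq → trans (cong (f (proj₁ pq) *_) (g≈0 (proj₂ pq))) (*-zeroʳ (f (proj₁ pq)))))
  (sumL-zero (splitMon μ))

*ₛ-negʳ : ∀ f g → f *ₛ (-ₛ g) ≈ₛ -ₛ (f *ₛ g)
*ₛ-negʳ f g μ = trans
  (sumL-cong (splitMon μ) (λ pq → sym (neg-distribʳ-* (f (proj₁ pq)) (g (proj₂ pq)))))
  (sumL-neg _ (splitMon μ))

*ₛ-signʳ : ∀ n f g → f *ₛ signₛ n g ≈ₛ signₛ n (f *ₛ g)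
*ₛ-signʳ zero    f g μ = refl
*ₛ-signʳ (suc n) f g   = ≈ₛ-trans (*ₛ-negʳ f (signₛ n g)) (-ₛ-cong (*ₛ-signʳ n f g))

signₛ-+ : ∀ a b f → signₛ a (signₛ b f) ≈ₛ signₛ (a ℕ.+ b) f
signₛ-+ zero    b f μ = refl
signₛ-+ (suc a) b f   = -ₛ-cong (signₛ-+ a b f)

signₛ-neg : ∀ n f → signₛ n (-ₛ f) ≈ₛ -ₛ signₛ n f
signₛ-neg zero    f μ = refl
signₛ-neg (suc n) f   = -ₛ-cong (signₛ-neg n f)

signₛ-involutive : ∀ n f → signₛ n (signₛ n f) ≈ₛ f
signₛ-involutive zero    f μ = refl
signₛ-involutive (suc n) f   = ≈ₛ-trans (-ₛ-cong (signₛ-neg n (signₛ n f)))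
  (λ μ → trans (neg-involutive _) (signₛ-involutive n f μ))

signₛ-zero : ∀ n {f} → f ≈ₛ 0ₛ → signₛ n f ≈ₛ 0ₛ
signₛ-zero zero    f≈0   = f≈0
signₛ-zero (suc n) f≈0 μ = cong -_ (signₛ-zero n f≈0 μ)

sumFin-cong : ∀ n {f g : Fin n → Series} → (∀ j → f j ≈ₛ g j) → sumFin n f ≈ₛ sumFin n g
sumFin-cong zero    f≈g μ = refl
sumFin-cong (suc n) f≈g   = +ₛ-cong (f≈g Fin.zero) (sumFin-cong n (f≈g ∘ Fin.suc))

sumFin-zero : ∀ n {f : Fin n → Series} → (∀ j → f j ≈ₛ 0ₛ) → sumFin n f ≈ₛ 0ₛ
sumFin-zero zero    f≈0 μ = refl
sumFin-zero (suc n) f≈0 μ =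
  trans (cong₂ _+_ (f≈0 Fin.zero μ) (sumFin-zero n (f≈0 ∘ Fin.suc) μ)) (+-identityˡ 0ℚ)

-ₛ-sumFin : ∀ n (f : Fin n → Series) → -ₛ sumFin n f ≈ₛ sumFin n (-ₛ_ ∘ f)
-ₛ-sumFin zero    f μ = refl
-ₛ-sumFin (suc n) f μ =
  trans (neg-distrib-+ (f Fin.zero μ) _) (cong (- f Fin.zero μ +_) (-ₛ-sumFin n (f ∘ Fin.suc) μ))

signₛ-sumFin : ∀ k n (f : Fin n → Series) → signₛ k (sumFin n f) ≈ₛ sumFin n (signₛ k ∘ f)
signₛ-sumFin zero    n f μ = refl
signₛ-sumFin (suc k) n f   = ≈ₛ-trans (-ₛ-cong (signₛ-sumFin k n f)) (-ₛ-sumFin n (signₛ k ∘ f))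

sumFin-sumBelow : ∀ n (f : ℕ → Series) μ → sumFin n (f ∘ toℕ) μ ≡ ∑[ i < n ] f i μ
sumFin-sumBelow zero    f μ = refl
sumFin-sumBelow (suc n) f μ = cong (f 0 μ +_) (sumFin-sumBelow n (f ∘ suc) μ)

det-cong : ∀ n {A B : Fin n → Fin n → Series} → (∀ k l → A k l ≈ₛ B k l) → det n A ≈ₛ det n B
det-cong zero    A≈B μ = refl
det-cong (suc n) A≈B   = sumFin-cong (suc n) (λ j → signₛ-cong (toℕ j)
  (*ₛ-cong (A≈B Fin.zero j) (det-cong n (λ k l → A≈B (Fin.suc k) (punchIn j l)))))

minor : ∀ {n} → (Fin (suc n) → Fin (suc n) → Series) → Fin (suc n) → Fin n → Fin n → Series
minor A j k l = A (Fin.suc k) (punchIn j l)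

det-zeroColumn : ∀ n (A : Fin n → Fin n → Series) c → (∀ k → A k c ≈ₛ 0ₛ) → det n A ≈ₛ 0ₛ
minor-zeroColumn : ∀ n (A : Fin (suc n) → Fin (suc n) → Series) {j c} → j ≢ c →
  (∀ k → A (Fin.suc k) c ≈ₛ 0ₛ) → det n (minor A j) ≈ₛ 0ₛ

det-zeroColumn (suc n) A c Ac≈0 = sumFin-zero (suc n) cofactor≈0
  where
  cofactor≈0 : ∀ j → signₛ (toℕ j) (A Fin.zero j *ₛ det n (minor A j)) ≈ₛ 0ₛ
  cofactor≈0 j with j ≟ᶠ c
  ... | yes refl = signₛ-zero (toℕ j) (*ₛ-zeroˡ _ (Ac≈0 Fin.zero))
  ... | no  j≢c  = signₛ-zero (toℕ j) (*ₛ-zeroʳ (A Fin.zero j) (minor-zeroColumn n A j≢c (Ac≈0 ∘ Fin.suc)))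

minor-zeroColumn n A {j} j≢c Ac≈0 = det-zeroColumn n (minor A j) (punchOut j≢c)
  (λ k μ → trans (cong (λ l → A (Fin.suc k) l μ) (punchIn-punchOut j≢c)) (Ac≈0 k μ))

det-unitFirstColumn : ∀ n (A : Fin (suc n) → Fin (suc n) → Series) →
  A Fin.zero Fin.zero ≈ₛ 1ₛ → (∀ k → A (Fin.suc k) Fin.zero ≈ₛ 0ₛ) →
  det (suc n) A ≈ₛ det n (minor A Fin.zero)
det-unitFirstColumn n A A₀₀≈1 A₀≈0 μ = begin
  det (suc n) A μ
    ≡⟨ cong₂ _+_ (≈ₛ-trans (*ₛ-cong A₀₀≈1 (λ _ → refl)) (*ₛ-identityˡ _) μ)
                 (sumFin-zero n (λ j → signₛ-zero (suc (toℕ j)) (*ₛ-zeroʳ (A Fin.zero (Fin.suc j))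
                    (minor-zeroColumn n A {Fin.suc j} (λ ()) A₀≈0))) μ) ⟩
  det n (minor A Fin.zero) μ + 0ℚ
    ≡⟨ +-identityʳ _ ⟩
  det n (minor A Fin.zero) μ ∎
  where open ≡-Reasoning

-- Toeplitz determinants

punchInℕ : ℕ → ℕ → ℕ
punchInℕ zero    l       = suc l
punchInℕ (suc a) zero    = zero
punchInℕ (suc a) (suc l) = suc (punchInℕ a l)

toℕ-punchIn : ∀ {n} (j : Fin (suc n)) (l : Fin n) → toℕ (punchIn j l) ≡ punchInℕ (toℕ j) (toℕ l)
toℕ-punchIn Fin.zero    l           = refl
toℕ-punchIn (Fin.suc j) Fin.zero    = refl
toℕ-punchIn (Fin.suc j) (Fin.suc l) = cong suc (toℕ-punchIn j l)

idx≡⊖ : ∀ {n} (i j : Fin n) → idx i j ≡ suc (toℕ j) ⊖ toℕ i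
idx≡⊖ i j =
  trans (cong (ℤ._+ ℤ.+ toℕ j) (ℤP.[+m]-[+n]≡m⊖n 1 (toℕ i))) (ℤP.distribˡ-⊖-+-pos (toℕ j) 1 (toℕ i))

module Toeplitz (F : ℤ → Series) (G : ℕ → Series)
  (F₀≈1 : F (ℤ.+ 0) ≈ₛ 1ₛ) (G₀≈1 : G 0 ≈ₛ 1ₛ) (F-neg≈0 : ∀ k → F -[1+ k ] ≈ₛ 0ₛ)
  (F⊛G≈0 : ∀ n → sumFin (suc (suc n)) (λ i → F (ℤ.+ toℕ i) *ₛ G (suc n ∸ toℕ i)) ≈ₛ 0ₛ) where

  toeplitz : ∀ n → Fin n → Fin n → Series
  toeplitz n k l = F (suc (toℕ l) ⊖ toℕ k)

  D : ℕ → Series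
  D n = det n (toeplitz n)

  -- The first-row minor of toeplitz (suc n) at column j is firstRowMinor (toℕ j) n. Its first
  -- toℕ j columns are a unit upper-triangular block with zeros below it, leaving toeplitz (n ∸ toℕ j).
  firstRowMinor : ℕ → ∀ n → Fin n → Fin n → Series
  firstRowMinor a n k l = F (punchInℕ a (toℕ l) ⊖ toℕ k)

  det-firstRowMinor : ∀ a n → a ≤ n → det n (firstRowMinor a n) ≈ₛ D (n ∸ a)
  det-firstRowMinor zero    n       _         μ = refl
  det-firstRowMinor (suc a) (suc n) (s≤s a≤n) = begin
    det (suc n) (firstRowMinor (suc a) (suc n))
      ≈⟨ det-unitFirstColumn n (firstRowMinor (suc a) (suc n)) F₀≈1 (F-neg≈0 ∘ toℕ) ⟩
    det n (λ k l → F (suc (punchInℕ a (toℕ l)) ⊖ suc (toℕ k)))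
      ≈⟨ det-cong n (λ k l μ → cong (λ z → F z μ) (ℤP.[1+m]⊖[1+n]≡m⊖n (punchInℕ a (toℕ l)) (toℕ k))) ⟩
    det n (firstRowMinor a n)
      ≈⟨ det-firstRowMinor a n a≤n ⟩
    D (n ∸ a) ∎
    where open ≈ₛ-Reasoning

  D-expand : ∀ n →
    D (suc n) ≈ₛ sumFin (suc n) (λ j → signₛ (toℕ j) (F (ℤ.+ suc (toℕ j)) *ₛ D (n ∸ toℕ j)))
  D-expand n = sumFin-cong (suc n) (λ j → signₛ-cong (toℕ j) (*ₛ-congˡ (F (ℤ.+ suc (toℕ j)))
    (≈ₛ-trans (det-cong n (λ k l μ → cong (λ z → F z μ)
                 (trans (ℤP.[1+m]⊖[1+n]≡m⊖n (toℕ (punchIn j l)) (toℕ k)) (cong (_⊖ toℕ k) (toℕ-punchIn j l)))))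
              (det-firstRowMinor (toℕ j) n (ℕP.≤-pred (toℕ<n j))))))

  F⊛G-tail : ∀ n → sumFin (suc n) (λ j → F (ℤ.+ suc (toℕ j)) *ₛ G (n ∸ toℕ j)) ≈ₛ -ₛ G (suc n)
  F⊛G-tail n μ = trans (+-inverseʳ-unique _ _ (F⊛G≈0 n μ))
                       (cong -_ (≈ₛ-trans (*ₛ-cong F₀≈1 (λ _ → refl)) (*ₛ-identityˡ (G (suc n))) μ))

  -- Indexing by j : Fin (suc n) makes the hypothesis available at every size n ∸ j ≤ n.
  D≈signG : ∀ n (j : Fin (suc n)) → D (n ∸ toℕ j) ≈ₛ signₛ (n ∸ toℕ j) (G (n ∸ toℕ j))
  D≈signG zero    Fin.zero    = ≈ₛ-sym G₀≈1
  D≈signG (suc n) (Fin.suc j) = D≈signG n j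
  D≈signG (suc n) Fin.zero    = begin
    D (suc n)
      ≈⟨ D-expand n ⟩
    sumFin (suc n) (λ j → signₛ (toℕ j) (F (ℤ.+ suc (toℕ j)) *ₛ D (n ∸ toℕ j)))
      ≈⟨ sumFin-cong (suc n) cofactor ⟩
    sumFin (suc n) (λ j → signₛ n (F (ℤ.+ suc (toℕ j)) *ₛ G (n ∸ toℕ j)))
      ≈⟨ signₛ-sumFin n (suc n) (λ j → F (ℤ.+ suc (toℕ j)) *ₛ G (n ∸ toℕ j)) ⟨
    signₛ n (sumFin (suc n) (λ j → F (ℤ.+ suc (toℕ j)) *ₛ G (n ∸ toℕ j)))
      ≈⟨ signₛ-cong n (F⊛G-tail n) ⟩
    signₛ n (-ₛ G (suc n))
      ≈⟨ signₛ-neg n (G (suc n)) ⟩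
    signₛ (suc n) (G (suc n)) ∎
    where
    open ≈ₛ-Reasoning
    cofactor : ∀ j → signₛ (toℕ j) (F (ℤ.+ suc (toℕ j)) *ₛ D (n ∸ toℕ j))
                   ≈ₛ signₛ n (F (ℤ.+ suc (toℕ j)) *ₛ G (n ∸ toℕ j))
    cofactor j = begin
      signₛ (toℕ j) (F (ℤ.+ suc (toℕ j)) *ₛ D (n ∸ toℕ j))
        ≈⟨ signₛ-cong (toℕ j) (*ₛ-congˡ (F (ℤ.+ suc (toℕ j))) (D≈signG n j)) ⟩
      signₛ (toℕ j) (F (ℤ.+ suc (toℕ j)) *ₛ signₛ (n ∸ toℕ j) (G (n ∸ toℕ j)))
        ≈⟨ signₛ-cong (toℕ j) (*ₛ-signʳ (n ∸ toℕ j) (F (ℤ.+ suc (toℕ j))) (G (n ∸ toℕ j))) ⟩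
      signₛ (toℕ j) (signₛ (n ∸ toℕ j) (F (ℤ.+ suc (toℕ j)) *ₛ G (n ∸ toℕ j)))
        ≈⟨ signₛ-+ (toℕ j) (n ∸ toℕ j) (F (ℤ.+ suc (toℕ j)) *ₛ G (n ∸ toℕ j)) ⟩
      signₛ (toℕ j ℕ.+ (n ∸ toℕ j)) (F (ℤ.+ suc (toℕ j)) *ₛ G (n ∸ toℕ j))
        ≡⟨ cong (λ k → signₛ k (F (ℤ.+ suc (toℕ j)) *ₛ G (n ∸ toℕ j))) (ℕP.m+[n∸m]≡n (ℕP.≤-pred (toℕ<n j))) ⟩
      signₛ n (F (ℤ.+ suc (toℕ j)) *ₛ G (n ∸ toℕ j)) ∎

  det-toeplitz : ∀ d → det d (λ i j → F (idx i j)) ≈ₛ signₛ d (G d)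
  det-toeplitz d = ≈ₛ-trans (det-cong d (λ k l μ → cong (λ z → F z μ) (idx≡⊖ k l))) (D≈signG d Fin.zero)

-- H⁺ and E⁺ as graded parts of multiplicative series

parity-+ : ∀ a b → parity (a ℕ.+ b) ≡ parity a * parity b
parity-+ zero    b = sym (*-identityˡ (parity b))
parity-+ (suc a) b = trans (cong -_ (parity-+ a b)) (neg-distribˡ-* (parity a) (parity b))

prodL-parity : ∀ r → prodL parity r ≡ parity (sumℕ r)
prodL-parity []      = refl
prodL-parity (x ∷ r) = trans (cong (parity x *_) (prodL-parity r)) (sym (parity-+ x (sumℕ r)))

Π-parity : ∀ ν → Π parity ν ≡ parity (area ν)
Π-parity []      = refl
Π-parity (r ∷ ν) = trans (cong₂ _*_ (prodL-parity r) (Π-parity ν)) (sym (parity-+ (sumℕ r) (area ν)))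

bit : ℕ → ℚ
bit k = ι (k ≤ᵇ 1)

H⁺-Π : ∀ i ν → H⁺ i ν ≡ δ (wdeg ν) i * Π parity ν
H⁺-Π i ν = trans (if-ι (wdeg ν ≡ᵇ i) (parity (area ν))) (cong (δ (wdeg ν) i *_) (sym (Π-parity ν)))

E⁺-Π : ∀ i ν → E⁺ i ν ≡ δ (wdeg ν) i * Π bit ν
E⁺-Π i ν = trans (ι-∧ (wdeg ν ≡ᵇ i) (squarefree ν)) (cong (δ (wdeg ν) i *_) (sym (Π-ι (_≤ᵇ 1) ν)))

-- The substitution x ↦ xᵐ

-- m = suc m′ so that 0 % m and 0 / m reduce.
module Stacks (m′ : ℕ) where

  m : ℕ
  m = suc m′

  -- dilate g is the coefficient sequence of Σₖ g k · tᵐᵏ.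
  dilate : (ℕ → ℚ) → ℕ → ℚ
  dilate g x = if x % m ≡ᵇ 0 then g (x / m) else 0ℚ

  0<[1+x]/m : ∀ x → (suc x % m ≡ᵇ 0) ≡ true → 0 < suc x / m
  0<[1+x]/m x m∣x with suc x / m in q≡
  ... | suc _ = s≤s z≤n
  ... | zero  = ⊥-elim (ℕP.0≢1+n (sym (trans (DivMod.m≡m%n+[m/n]*n (suc x) m)
                  (cong₂ (λ r q → r ℕ.+ q ℕ.* m) (≡ᵇ-sound _ 0 m∣x) q≡))))

  dilate-pos : ∀ g → (∀ k → 0 < k → g k ≡ 0ℚ) → ∀ x → dilate g (suc x) ≡ 0ℚ
  dilate-pos g g≡0 x with suc x % m ≡ᵇ 0 in m∣x
  ... | true  = g≡0 (suc x / m) (0<[1+x]/m x m∣x)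
  ... | false = refl

  dilate-small : ∀ g y → 0 < y → y < m → dilate g y ≡ 0ℚ
  dilate-small g (suc y) _ y<m rewrite DivMod.m<n⇒m%n≡m y<m = refl

  dilate-+m : ∀ g a → dilate g (a ℕ.+ m) ≡ dilate (g ∘ suc) a
  dilate-+m g a = cong₂ (λ r q → if r ≡ᵇ 0 then g q else 0ℚ) (DivMod.[m+n]%n≡m%n a m)
    (trans (DivMod.m/n≡1+[m∸n]/n (ℕP.m≤n+m m a)) (cong (λ b → suc (b / m)) (ℕP.m+n∸n≡m a m)))

  dilate-neg-cancel : ∀ g a → dilate g a + dilate (-_ ∘ g) a ≡ 0ℚ
  dilate-neg-cancel g a with a % m ≡ᵇ 0
  ... | true  = +-inverseʳ (g (a / m))
  ... | false = refl

  dilate-bit-large : ∀ y → m < y → dilate bit y ≡ 0ℚ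
  dilate-bit-large y m<y with y ∸ m in y∸m≡ | ℕP.m<n⇒0<n∸m m<y
  ... | suc k | _ = begin
    dilate bit y
      ≡⟨ cong (dilate bit) (trans (sym (ℕP.m∸n+n≡m (ℕP.<⇒≤ m<y))) (cong (ℕ._+ m) y∸m≡)) ⟩
    dilate bit (suc k ℕ.+ m)
      ≡⟨ dilate-+m bit (suc k) ⟩
    dilate (bit ∘ suc) (suc k)
      ≡⟨ dilate-pos (bit ∘ suc) (λ { (suc j) _ → refl }) k ⟩
    0ℚ ∎
    where open ≡-Reasoning

  ⊛-below-m : ∀ E → 0 < E → E < m → (dilate parity ⊛ dilate bit) E ≡ 0ℚ
  ⊛-below-m E 0<E E<m = begin
    sumBelow (suc E) term                ≡⟨ sumBelow-snoc E term ⟩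
    sumBelow E term + term E             ≡⟨ cong₂ _+_ (sumBelow-zero E bitVanishes) parityVanishes ⟩
    0ℚ + 0ℚ                              ≡⟨ +-identityʳ 0ℚ ⟩
    0ℚ                                   ∎
    where
    open ≡-Reasoning
    term : ℕ → ℚ
    term x = dilate parity x * dilate bit (E ∸ x)
    bitVanishes : ∀ x → x < E → term x ≡ 0ℚ
    bitVanishes x x<E = trans
      (cong (dilate parity x *_)
            (dilate-small bit (E ∸ x) (ℕP.m<n⇒0<n∸m x<E) (ℕP.≤-<-trans (ℕP.m∸n≤m E x) E<m)))
      (*-zeroʳ (dilate parity x))
    parityVanishes : term E ≡ 0ℚ
    parityVanishes =
      trans (cong (_* dilate bit (E ∸ E)) (dilate-small parity E 0<E E<m)) (*-zeroˡ (dilate bit (E ∸ E)))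

  -- Only x = a and x = a + m contribute, and there parity has opposite signs.
  ⊛-beyond-m : ∀ a → (dilate parity ⊛ dilate bit) (a ℕ.+ m) ≡ 0ℚ
  ⊛-beyond-m a = begin
    sumBelow (suc (a ℕ.+ m)) term
      ≡⟨ sumBelow-snoc (a ℕ.+ m) term ⟩
    sumBelow (a ℕ.+ m) term + term (a ℕ.+ m)
      ≡⟨ cong (_+ term (a ℕ.+ m)) (sumBelow-+ a m term) ⟩
    (sumBelow a term + (term (a ℕ.+ 0) + ∑[ x < m′ ] term (a ℕ.+ suc x))) + term (a ℕ.+ m)
      ≡⟨ cong₂ _+_ (cong₂ _+_ (sumBelow-zero a beforeA) (cong₂ _+_ atA (sumBelow-zero m′ strictlyBetween))) atEnd ⟩
    (0ℚ + (dilate parity a + 0ℚ)) + dilate parity (a ℕ.+ m)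
      ≡⟨ cong (_+ dilate parity (a ℕ.+ m))
              (trans (+-identityˡ (dilate parity a + 0ℚ)) (+-identityʳ (dilate parity a))) ⟩
    dilate parity a + dilate parity (a ℕ.+ m)
      ≡⟨ cong (dilate parity a +_) (dilate-+m parity a) ⟩
    dilate parity a + dilate (-_ ∘ parity) a
      ≡⟨ dilate-neg-cancel parity a ⟩
    0ℚ ∎
    where
    open ≡-Reasoning
    term : ℕ → ℚ
    term x = dilate parity x * dilate bit ((a ℕ.+ m) ∸ x)
    beforeA : ∀ x → x < a → term x ≡ 0ℚ
    beforeA x x<a = trans
      (cong (dilate parity x *_) (dilate-bit-large _
        (subst (m <_) (sym (ℕP.+-∸-comm m (ℕP.<⇒≤ x<a))) (ℕP.m<n+m m (ℕP.m<n⇒0<n∸m x<a)))))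
      (*-zeroʳ (dilate parity x))
    atA : term (a ℕ.+ 0) ≡ dilate parity a
    atA = begin
      dilate parity (a ℕ.+ 0) * dilate bit ((a ℕ.+ m) ∸ (a ℕ.+ 0))
        ≡⟨ cong₂ (λ x y → dilate parity x * dilate bit y) (ℕP.+-identityʳ a) (ℕP.[m+n]∸[m+o]≡n∸o a m 0) ⟩
      dilate parity a * dilate bit m
        ≡⟨ cong (dilate parity a *_) (dilate-+m bit 0) ⟩
      dilate parity a * 1ℚ
        ≡⟨ *-identityʳ (dilate parity a) ⟩
      dilate parity a ∎
    strictlyBetween : ∀ x → x < m′ → term (a ℕ.+ suc x) ≡ 0ℚ
    strictlyBetween x x<m′ = trans
      (cong (λ y → dilate parity (a ℕ.+ suc x) * dilate bit y) (ℕP.[m+n]∸[m+o]≡n∸o a m (suc x)))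
      (trans (cong (dilate parity (a ℕ.+ suc x) *_)
                   (dilate-small bit (m′ ∸ x) (ℕP.m<n⇒0<n∸m x<m′) (s≤s (ℕP.m∸n≤m m′ x))))
             (*-zeroʳ (dilate parity (a ℕ.+ suc x))))
    atEnd : term (a ℕ.+ m) ≡ dilate parity (a ℕ.+ m)
    atEnd = trans (cong (λ y → dilate parity (a ℕ.+ m) * dilate bit y) (ℕP.n∸n≡0 (a ℕ.+ m)))
                  (*-identityʳ (dilate parity (a ℕ.+ m)))

  dilate-parity⊛dilate-bit : ∀ e → (dilate parity ⊛ dilate bit) e ≡ δ e 0
  dilate-parity⊛dilate-bit zero    = refl
  dilate-parity⊛dilate-bit (suc e) with m ℕP.≤? suc e
  ... | yes m≤E =
    subst (λ E → (dilate parity ⊛ dilate bit) E ≡ 0ℚ) (ℕP.m∸n+n≡m m≤E) (⊛-beyond-m (suc e ∸ m))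
  ... | no  m≰E = ⊛-below-m (suc e) (s≤s z≤n) (ℕP.≰⇒> m≰E)

  divisible : Mon → Bool
  divisible μ = and (map (divRow m) μ)

  quotientRow : List ℕ → List ℕ
  quotientRow = map (_/ m)

  quotient : Mon → Mon
  quotient = map quotientRow

  weight : Mon → ℕ
  weight μ = wdeg (quotient μ)

  stackPart : (ℕ → ℚ) → ℕ → Series
  stackPart g i μ = δ (weight μ) i * Π (dilate g) μ

  prodL-dilate : ∀ g r → prodL (dilate g) r ≡ (if divRow m r then prodL g (quotientRow r) else 0ℚ)
  prodL-dilate g []      = refl
  prodL-dilate g (x ∷ r) = trans (cong (dilate g x *_) (prodL-dilate g r))
                                 (sym (if-∧-* (x % m ≡ᵇ 0) (divRow m r) _ _))

  Π-dilate : ∀ g μ → Π (dilate g) μ ≡ (if divisible μ then Π g (quotient μ) else 0ℚ)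
  Π-dilate g []      = refl
  Π-dilate g (r ∷ μ) = trans (cong₂ _*_ (prodL-dilate g r) (Π-dilate g μ))
                             (sym (if-∧-* (divRow m r) (divisible μ) _ _))

  Π-dilate-indivisible : ∀ g μ → divisible μ ≡ false → Π (dilate g) μ ≡ 0ℚ
  Π-dilate-indivisible g μ indivisible =
    trans (Π-dilate g μ) (cong (if_then Π g (quotient μ) else 0ℚ) indivisible)

  powSubst-stackPart : ∀ f g i → (∀ ν → f ν ≡ δ (wdeg ν) i * Π g ν) → powSubst m f ≈ₛ stackPart g i
  powSubst-stackPart f g i f≡ μ = byDivisibility (divisible μ) (Π-dilate g μ)
    where
    byDivisibility : ∀ b → Π (dilate g) μ ≡ (if b then Π g (quotient μ) else 0ℚ) →
      (if b then f (quotient μ) else 0ℚ) ≡ stackPart g i μ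
    byDivisibility true  Π≡ = trans (f≡ (quotient μ)) (cong (δ (weight μ) i *_) (sym Π≡))
    byDivisibility false Π≡ = sym (trans (cong (δ (weight μ) i *_) Π≡) (*-zeroʳ (δ (weight μ) i)))

  divRow-head : ∀ x a → divRow m (x ∷ a) ≡ true → x % m ≡ 0
  divRow-head x a m∣xa = ≡ᵇ-sound (x % m) 0 (∧-conicalˡ (x % m ≡ᵇ 0) (divRow m a) m∣xa)

  divRow-tail : ∀ x a → divRow m (x ∷ a) ≡ true → divRow m a ≡ true
  divRow-tail x a = ∧-conicalʳ (x % m ≡ᵇ 0) (divRow m a)

  quotientRow-split : ∀ {a b r} → RowSplit a b r → divRow m a ≡ true → divRow m b ≡ true →
    sumℕ (quotientRow a) ℕ.+ sumℕ (quotientRow b) ≡ sumℕ (quotientRow r)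
  quotientRow-split [] _ _ = refl
  quotientRow-split {x ∷ a} {y ∷ b} {e ∷ r} (x+y≡e ∷ split) m∣xa m∣yb =
    trans (ℕ-+-interchange (x / m) (sumℕ (quotientRow a)) (y / m) (sumℕ (quotientRow b)))
          (cong₂ ℕ._+_ /-+ (quotientRow-split split (divRow-tail x a m∣xa) (divRow-tail y b m∣yb)))
    where
    remainders<m : x % m ℕ.+ y % m < m
    remainders<m = subst (_< m) (sym (cong₂ ℕ._+_ (divRow-head x a m∣xa) (divRow-head y b m∣yb))) (s≤s z≤n)
    /-+ : x / m ℕ.+ y / m ≡ e / m
    /-+ = trans (sym (DivMod.+-distrib-/ x y remainders<m)) (cong (_/ m) x+y≡e)

  weight-split : ∀ k {p q μ} → MonSplit p q μ → divisible p ≡ true → divisible q ≡ true →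
    wdegFrom k (quotient p) ℕ.+ wdegFrom k (quotient q) ≡ wdegFrom k (quotient μ)
  weight-split k [] _ _ = refl
  weight-split k {a ∷ p} {b ∷ q} (rowSplit ∷ split) m∣ap m∣bq =
    trans (ℕ-+-interchange (k ℕ.* sumℕ (quotientRow a)) _ (k ℕ.* sumℕ (quotientRow b)) _)
          (cong₂ ℕ._+_
            (trans (sym (ℕP.*-distribˡ-+ k _ _))
                   (cong (k ℕ.*_) (quotientRow-split rowSplit (∧-conicalˡ _ _ m∣ap) (∧-conicalˡ _ _ m∣bq))))
            (weight-split (suc k) split (∧-conicalʳ _ _ m∣ap) (∧-conicalʳ _ _ m∣bq)))

  zeroRow-quotient : ∀ r → isZeroRow r ≡ true → sumℕ (quotientRow r) ≡ 0
  zeroRow-quotient []         _      = refl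
  zeroRow-quotient (zero ∷ r) r≡0 = zeroRow-quotient r r≡0

  isOne-weight : ∀ k μ → isOne μ ≡ true → wdegFrom k (quotient μ) ≡ 0
  isOne-weight k []      _     = refl
  isOne-weight k (r ∷ μ) μ≡1 = cong₂ ℕ._+_
    (trans (cong (k ℕ.*_) (zeroRow-quotient r (∧-conicalˡ _ _ μ≡1))) (ℕP.*-zeroʳ k))
    (isOne-weight (suc k) μ (∧-conicalʳ _ _ μ≡1))

  zeroRow-prodL : ∀ φ → φ 0 ≡ 1ℚ → ∀ r → isZeroRow r ≡ true → prodL φ r ≡ 1ℚ
  zeroRow-prodL φ φ0≡1 []         _   = refl
  zeroRow-prodL φ φ0≡1 (zero ∷ r) r≡0 = trans (cong₂ _*_ φ0≡1 (zeroRow-prodL φ φ0≡1 r r≡0)) (*-identityˡ 1ℚ)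

  isOne-Π : ∀ φ → φ 0 ≡ 1ℚ → ∀ μ → isOne μ ≡ true → Π φ μ ≡ 1ℚ
  isOne-Π φ φ0≡1 []      _   = refl
  isOne-Π φ φ0≡1 (r ∷ μ) μ≡1 = trans
    (cong₂ _*_ (zeroRow-prodL φ φ0≡1 r (∧-conicalˡ _ _ μ≡1)) (isOne-Π φ φ0≡1 μ (∧-conicalʳ _ _ μ≡1)))
    (*-identityˡ 1ℚ)

  nonzeroRow-quotient : ∀ r → isZeroRow r ≡ false → divRow m r ≡ true → 0 < sumℕ (quotientRow r)
  nonzeroRow-quotient (zero  ∷ r) r≢0 m∣r = nonzeroRow-quotient r r≢0 m∣r
  nonzeroRow-quotient (suc x ∷ r) _   m∣r =
    ℕP.<-≤-trans (0<[1+x]/m x (∧-conicalˡ _ _ m∣r)) (ℕP.m≤m+n _ _)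

  nonOne-weight : ∀ k μ → isOne μ ≡ false → divisible μ ≡ true → 0 < wdegFrom (suc k) (quotient μ)
  nonOne-weight k (r ∷ μ) μ≢1 m∣μ with isZeroRow r in r≡0?
  ... | false = ℕP.<-≤-trans (nonzeroRow-quotient r r≡0? (∧-conicalˡ _ _ m∣μ))
                             (ℕP.≤-trans (ℕP.m≤m+n _ (k ℕ.* _)) (ℕP.m≤m+n _ _))
  ... | true  = ℕP.<-≤-trans (nonOne-weight (suc k) μ μ≢1 (∧-conicalʳ _ _ m∣μ)) (ℕP.m≤n+m _ _)

  stackPart-zero : ∀ g → g 0 ≡ 1ℚ → stackPart g 0 ≈ₛ 1ₛ
  stackPart-zero g g0≡1 μ with isOne μ in μ≡1? | divisible μ in m∣μ?
  ... | true  | _     = trans (cong₂ _*_ (cong (λ w → δ w 0) (isOne-weight 1 μ μ≡1?))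
                                         (isOne-Π (dilate g) g0≡1 μ μ≡1?))
                              (*-identityˡ 1ℚ)
  ... | false | true  = trans (cong (_* Π (dilate g) μ) (δ-pos-0 (nonOne-weight 0 μ μ≡1? m∣μ?)))
                              (*-zeroˡ (Π (dilate g) μ))
  ... | false | false = trans (cong (δ (weight μ) 0 *_) (Π-dilate-indivisible g μ m∣μ?))
                              (*-zeroʳ (δ (weight μ) 0))

  positiveWeight-1ₛ : ∀ s μ → δ (weight μ) (suc s) * 1ₛ μ ≡ 0ℚ
  positiveWeight-1ₛ s μ with isOne μ in μ≡1?
  ... | true  = cong (λ w → δ w (suc s) * 1ℚ) (isOne-weight 1 μ μ≡1?)
  ... | false = *-zeroʳ (δ (weight μ) (suc s))

  module Convolution (g h : ℕ → ℚ) (g⊛h≡δ : ∀ e → (dilate g ⊛ dilate h) e ≡ δ e 0) where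

    Πg*Πh : Mon × Mon → ℚ
    Πg*Πh (p , q) = Π (dilate g) p * Π (dilate h) q

    stackPart-⊛ : ∀ N p q → ∑[ i < suc N ] (stackPart g i p * stackPart h (N ∸ i) q)
                           ≡ δ (weight p ℕ.+ weight q) N * Πg*Πh (p , q)
    stackPart-⊛ N p q = begin
      ∑[ i < suc N ] (stackPart g i p * stackPart h (N ∸ i) q)
        ≡⟨ sumBelow-cong (suc N) (λ i _ →
             *-interchange (δ (weight p) i) (Π (dilate g) p) (δ (weight q) (N ∸ i)) (Π (dilate h) q)) ⟩
      ∑[ i < suc N ] (δ (weight p) i * δ (weight q) (N ∸ i) * Πg*Πh (p , q))
        ≡⟨ sumBelow-*ʳ (suc N) (λ i → δ (weight p) i * δ (weight q) (N ∸ i)) (Πg*Πh (p , q)) ⟩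
      (δ (weight p) ⊛ δ (weight q)) N * Πg*Πh (p , q)
        ≡⟨ cong (_* Πg*Πh (p , q)) (δ-⊛ (weight p) (weight q) N) ⟩
      δ (weight p ℕ.+ weight q) N * Πg*Πh (p , q) ∎
      where open ≡-Reasoning

    -- weight is additive on a splitting when both parts are divisible by m; otherwise Πg*Πh vanishes.
    weight-on-support : ∀ N {p q μ} → MonSplit p q μ →
      δ (weight p ℕ.+ weight q) N * Πg*Πh (p , q) ≡ δ (weight μ) N * Πg*Πh (p , q)
    weight-on-support N {p} {q} {μ} split with divisible p in m∣p? | divisible q in m∣q?
    ... | true  | true  = cong (λ w → δ w N * Πg*Πh (p , q)) (weight-split 1 split m∣p? m∣q?)
    ... | false | _     = *-cong-zeroʳ (δ (weight p ℕ.+ weight q) N) (δ (weight μ) N)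
                            (trans (cong (_* Π (dilate h) q) (Π-dilate-indivisible g p m∣p?)) (*-zeroˡ (Π (dilate h) q)))
    ... | true  | false = *-cong-zeroʳ (δ (weight p ℕ.+ weight q) N) (δ (weight μ) N)
                            (trans (cong (Π (dilate g) p *_) (Π-dilate-indivisible h q m∣q?)) (*-zeroʳ (Π (dilate g) p)))

    stackPart-convolution : ∀ N μ →
      ∑[ i < suc N ] (stackPart g i *ₛ stackPart h (N ∸ i)) μ ≡ δ (weight μ) N * 1ₛ μ
    stackPart-convolution N μ = begin
      ∑[ i < suc N ] sumL (λ pq → stackPart g i (proj₁ pq) * stackPart h (N ∸ i) (proj₂ pq)) (splitMon μ)
        ≡⟨ sumBelow-sumL (λ i pq → stackPart g i (proj₁ pq) * stackPart h (N ∸ i) (proj₂ pq))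
                         (suc N) (splitMon μ) ⟩
      sumL (λ pq → ∑[ i < suc N ] (stackPart g i (proj₁ pq) * stackPart h (N ∸ i) (proj₂ pq))) (splitMon μ)
        ≡⟨ sumL-cong (splitMon μ) (λ pq → stackPart-⊛ N (proj₁ pq) (proj₂ pq)) ⟩
      sumL (λ pq → δ (weight (proj₁ pq) ℕ.+ weight (proj₂ pq)) N * Πg*Πh pq) (splitMon μ)
        ≡⟨ sumL-splitMon-cong μ (λ p q split → weight-on-support N split) ⟩
      sumL (λ pq → δ (weight μ) N * Πg*Πh pq) (splitMon μ)
        ≡⟨ sumL-*ˡ (δ (weight μ) N) Πg*Πh (splitMon μ) ⟩
      δ (weight μ) N * (Π (dilate g) *ₛ Π (dilate h)) μ
        ≡⟨ cong (δ (weight μ) N *_) (Π-*ₛ (dilate g) (dilate h) μ) ⟩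
      δ (weight μ) N * Π (dilate g ⊛ dilate h) μ
        ≡⟨ cong (δ (weight μ) N *_) (trans (prodL-cong μ (λ r → prodL-cong r g⊛h≡δ)) (Π-ι (_≡ᵇ 0) μ)) ⟩
      δ (weight μ) N * 1ₛ μ ∎
      where open ≡-Reasoning

    stackPart-convolution-suc : ∀ s →
      sumFin (suc (suc s)) (λ i → stackPart g (toℕ i) *ₛ stackPart h (suc s ∸ toℕ i)) ≈ₛ 0ₛ
    stackPart-convolution-suc s μ = trans
      (sumFin-sumBelow (suc (suc s)) (λ i → stackPart g i *ₛ stackPart h (suc s ∸ i)) μ)
      (trans (stackPart-convolution (suc s) μ) (positiveWeight-1ₛ s μ))

  stack-inversion : ∀ (F G : ℕ → Series) (g h : ℕ → ℚ) →
    (∀ i ν → F i ν ≡ δ (wdeg ν) i * Π g ν) → (∀ i ν → G i ν ≡ δ (wdeg ν) i * Π h ν) →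
    g 0 ≡ 1ℚ → h 0 ≡ 1ℚ → (∀ e → (dilate g ⊛ dilate h) e ≡ δ e 0) →
    ∀ d → stack G (ℤ.+ d) m ≈ₛ signₛ d (det d (λ i j → stack F (idx i j) m))
  stack-inversion F G g h F≡ G≡ g0≡1 h0≡1 g⊛h≡δ d =
    ≈ₛ-trans (≈ₛ-sym (signₛ-involutive d (stack G (ℤ.+ d) m))) (signₛ-cong d (≈ₛ-sym (det-toeplitz d)))
    where
    stackF≈ : ∀ i → stack F (ℤ.+ i) m ≈ₛ stackPart g i
    stackF≈ i = powSubst-stackPart (F i) g i (F≡ i)
    stackG≈ : ∀ i → stack G (ℤ.+ i) m ≈ₛ stackPart h i
    stackG≈ i = powSubst-stackPart (G i) h i (G≡ i)
    open Convolution g h g⊛h≡δ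
    open Toeplitz (λ z → stack F z m) (λ n → stack G (ℤ.+ n) m)
      (≈ₛ-trans (stackF≈ 0) (stackPart-zero g g0≡1))
      (≈ₛ-trans (stackG≈ 0) (stackPart-zero h h0≡1))
      (λ k μ → refl)
      (λ n → ≈ₛ-trans
         (sumFin-cong (suc (suc n)) (λ i → *ₛ-cong (stackF≈ (toℕ i)) (stackG≈ (suc n ∸ toℕ i))))
         (stackPart-convolution-suc n))

-- Opened only here: with +_ in scope, sections such as (x +_) above would be ambiguous.
open import Data.Integer using (+_)

mainTheorem2 : (d m : ℕ) .{{_ : NonZero d}} .{{_ : NonZero m}} →
    (stack E⁺ (+ d) m ≈ₛ signₛ d (det d (λ i j → stack H⁺ (idx i j) m)))
    × (stack H⁺ (+ d) m ≈ₛ signₛ d (det d (λ i j → stack E⁺ (idx i j) m)))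
mainTheorem2 d (suc m′) =
    stack-inversion H⁺ E⁺ parity bit H⁺-Π E⁺-Π refl refl dilate-parity⊛dilate-bit d
  , stack-inversion E⁺ H⁺ bit parity E⁺-Π H⁺-Π refl refl
      (λ e → trans (⊛-comm (dilate bit) (dilate parity) e) (dilate-parity⊛dilate-bit e)) d
  where open Stacks m′
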